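{- Let $\mathcal{J}=\{1,\ldots,n\}$ be a set of jobs indexed so that $p_1\le\cdots\le p_n$, with tied jobs ordered by non-decreasing weight, let $i_1<\cdots<i_\ell$ be its key sequence and $\mathcal{S}_{\mathrm{key}}$ the synchronized schedule $(i_1,\ldots,i_\ell)$. Let $\mathcal{S}_{\mathrm{opt}}=(\pi(1),\ldots,\pi(m))$ be an optimal synchronized schedule with shared-processor completion times $C_{\pi(1)}<\cdots<C_{\pi(m)}$, and $e^*=\sum_{j=1}^m w_{\pi(j)}(C_{\pi(j)}-C_{\pi(j-1)})$ with $C_{\pi(0)}=0$. Then $e^*/2\le W(\mathcal{S}_{\mathrm{key}})\le e^*$, where $W$ denotes total weighted overlap.
   Context: Weighted Single-Processor Scheduling: job $j$ has processing time $p_j>0$ and weight $w_j\ge0$, its own private processor $\mathcal{P}_j$, and there is one shared processor $\mathcal{M}$. A feasible schedule: each job $j$ executes on $\mathcal{P}_j$ in a single interval $(0,C_j^{\mathcal{P}})$ and on $\mathcal{M}$ in a (possibly empty) collection $\mathcal{I}_j$ of open intervals, with $C_j^{\mathcal{P}}+\sum_{I\in\mathcal{I}_j}|I|=p_j$, and all intervals on $\mathcal{M}$ pairwise disjoint. The total overlap $t_j$ is the total time $j$ executes simultaneously on $\mathcal{P}_j$ and $\mathcal{M}$; the total weighted overlap is $W(\mathcal{S})=\sum_j t_jw_j$, and a feasible schedule maximizing it is optimal. For a sequence $(j_1,\ldots,j_k)$ of distinct jobs, the synchronized schedule $(j_1,\ldots,j_k)$ lets $j_i$ execute on $\mathcal{M}$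 exactly in $(S_i,C_i)$ where $C_0=0$, $S_i=C_{i-1}$, $C_i=(p_{j_i}+S_i)/2$, and on $\mathcal{P}_{j_i}$ in $(0,C_i)$; other jobs run only on their private processors. An optimal synchronized schedule always exists. Key sequence: $1\le i_1<\cdots<i_\ell\le n$ with (i) $i_\ell=n$; (ii) $w_{i_1}>\cdots>w_{i_\ell}$; (iii) $w_k\le w_{i_j}$ for each $j\in\{1,\ldots,\ell\}$ and $k\in\{i_{j-1}+1,\ldots,i_j\}$, where $i_0=0$ (it exists and is unique).
   Formalization: The processing times $p_j$, the weights $w_j$ and all schedule times are rational, including the times of the competing schedules against which optimality of $\mathcal{S}_{\mathrm{opt}}$ is measured. -}

module Defs where

open import Data.Nat as ℕ using (ℕ; zero; suc)
open import Data.Fin as Fin using (Fin; toℕ; inject₁)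
open import Data.Rational using (ℚ; 0ℚ; ½; _+_; _-_; _*_; _≤_; _<_; _⊔_; _⊓_)
open import Data.List using (List; []; _∷_; length; lookup; map; foldr; tabulate)
open import Data.List.Relation.Unary.Unique.Propositional using (Unique)
open import Data.Sum using (_⊎_)
open import Data.Unit using (⊤)
open import Data.Maybe using (Maybe; just; nothing)
open import Data.Product using (Σ; _×_; _,_; proj₁; proj₂)
open import Relation.Binary.PropositionalEquality using (_≡_)
open import Relation.Nullary using (¬_; yes; no)

sumℚ : List ℚ → ℚ
sumℚ = foldr _+_ 0ℚ

Σjobs : {n : ℕ} → (Fin n → ℚ) → ℚ
Σjobs f = sumℚ (tabulate f)

-- Jobs are Fin n (job k+1 of the paper is
-- the element of Fin n with toℕ = k).  An open interval (a , b) on the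
-- shared processor M is stored as its pair of endpoints.

record Schedule (n : ℕ) : Set where
  field
    CP  : Fin n → ℚ                  -- completion time C_j^P on P_j
    Ivs : Fin n → List (ℚ × ℚ)       -- the collection I_j of intervals on M

open Schedule public

len : ℚ × ℚ → ℚ
len (a , b) = b - a

Disjoint : ℚ × ℚ → ℚ × ℚ → Set
Disjoint (a , b) (a' , b') = (b ≤ a') ⊎ (b' ≤ a)

record Feasible {n : ℕ} (p : Fin n → ℚ) (S : Schedule n) : Set where
  field
    cp-nonneg : ∀ j → 0ℚ ≤ CP S j
    iv-wf     : ∀ j (x : Fin (length (Ivs S j))) →
                  0ℚ ≤ proj₁ (lookup (Ivs S j) x) × proj₁ (lookup (Ivs S j) x) ≤ proj₂ (lookup (Ivs S j) x)
    total     : ∀ j → CP S j + sumℚ (map len (Ivs S j)) ≡ p j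
    disjoint  : ∀ j j' (x : Fin (length (Ivs S j))) (y : Fin (length (Ivs S j'))) →
                  ¬ (Σ (j ≡ j') (λ _ → toℕ x ≡ toℕ y)) →
                  Disjoint (lookup (Ivs S j) x) (lookup (Ivs S j') y)

-- Length of (a , b) ∩ (0 , C), for 0 ≤ a.
overlapLen : ℚ → ℚ × ℚ → ℚ
overlapLen C (a , b) = 0ℚ ⊔ ((b ⊓ C) - (0ℚ ⊔ a))

overlapTime : {n : ℕ} → Schedule n → Fin n → ℚ
overlapTime S j = sumℚ (map (overlapLen (CP S j)) (Ivs S j))

W : {n : ℕ} → (w : Fin n → ℚ) → Schedule n → ℚ
W w S = Σjobs (λ j → overlapTime S j * w j)

Optimal : {n : ℕ} → (p w : Fin n → ℚ) → Schedule n → Set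
Optimal p w S = Feasible p S × (∀ S' → Feasible p S' → W w S' ≤ W w S)

syncTimes : {n : ℕ} → (Fin n → ℚ) → ℚ → List (Fin n) → List (Fin n × ℚ × ℚ)
syncTimes p s []       = []
syncTimes p s (j ∷ js) = (j , s , ½ * (p j + s)) ∷ syncTimes p (½ * (p j + s)) js

findJob : {n : ℕ} → Fin n → List (Fin n × ℚ × ℚ) → Maybe (ℚ × ℚ)
findJob j [] = nothing
findJob j ((k , SC) ∷ rest) with j Fin.≟ k
... | yes _ = just SC
... | no  _ = findJob j rest

syncSchedule : {n : ℕ} → (Fin n → ℚ) → List (Fin n) → Schedule n
syncSchedule p seq = record { CP = cp ; Ivs = ivs }
  where
  ts = syncTimes p 0ℚ seq
  cp : _ → ℚ
  cp j with findJob j ts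
  ... | just (S , C) = C
  ... | nothing      = p j
  ivs : _ → List (ℚ × ℚ)
  ivs j with findJob j ts
  ... | just SC = SC ∷ []
  ... | nothing = []

syncCompletions : {n : ℕ} → (Fin n → ℚ) → List (Fin n) → List ℚ
syncCompletions p seq = map (λ t → proj₂ (proj₂ t)) (syncTimes p 0ℚ seq)

StrictlyIncreasing : List ℚ → Set
StrictlyIncreasing []           = ⊤
StrictlyIncreasing (x ∷ [])     = ⊤
StrictlyIncreasing (x ∷ y ∷ xs) = (x < y) × StrictlyIncreasing (y ∷ xs)

estarGo : {n : ℕ} → (Fin n → ℚ) → ℚ → List (Fin n) → List ℚ → ℚ
estarGo w prev (j ∷ js) (C ∷ Cs) = w j * (C - prev) + estarGo w C js Cs
estarGo w prev _        _        = 0ℚ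

estar : {n : ℕ} → (p w : Fin n → ℚ) → List (Fin n) → ℚ
estar p w π = estarGo w 0ℚ π (syncCompletions p π)

SortedJobs : {n : ℕ} → (p w : Fin n → ℚ) → Set
SortedJobs p w = (∀ i j → i Fin.≤ j → p i ≤ p j)
               × (∀ i j → i Fin.≤ j → p i ≡ p j → w i ≤ w j)

-- Key sequence i_1 < … < i_ℓ, given as a map Fin ℓ → Fin n (0-based).

-- toℕ-lower bound for the block of i_a: 0 for a = 1, else (i_{a-1} + 1) (0-based).
prevEnd : {ℓ n : ℕ} → (Fin ℓ → Fin n) → Fin ℓ → ℕ
prevEnd i Fin.zero    = 0
prevEnd i (Fin.suc a) = suc (toℕ (i (inject₁ a)))

record IsKeySequence {n ℓ : ℕ} (w : Fin n → ℚ) (i : Fin ℓ → Fin n) : Set where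
  field
    increasing : ∀ a b → a Fin.< b → i a Fin.< i b
    last       : Σ (Fin ℓ) (λ a → suc (toℕ a) ≡ ℓ × suc (toℕ (i a)) ≡ n)
    decreasing : ∀ a b → a Fin.< b → w (i b) < w (i a)
    dominates  : ∀ a (k : Fin n) → prevEnd i a ℕ.≤ toℕ k → k Fin.≤ i a → w k ≤ w (i a)

keyList : {n ℓ : ℕ} → (Fin ℓ → Fin n) → List (Fin n)
keyList i = tabulate i

-- Think of the key sequence as a step function on the time axis: on
-- (p_{i_{a-1}}, p_{i_a}] it has height w_{i_a}.  By property (iii) and the
-- ordering of the jobs, every job j of the optimal schedule runs on M inside
-- (0, p_j) where this step function is at least w_j; as its intervals are
-- disjoint, e* is at most the area under the step function.  In the key
-- schedule, job i_a starts on M no later than p_{i_{a-1}} and runs for half of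
-- its remaining time, so it covers at least half of its step: W(S_key) is at
-- least half the area.  The upper bound is optimality of S_opt.
module Submission where

open import Defs
open import Data.Fin as Fin using (Fin; toℕ; inject₁)
import Data.Fin.Induction as Finᵢ
import Data.Fin.Properties as Finₚ
open import Data.List using (List; []; _∷_; map; tabulate)
open import Data.List.Properties using (tabulate-cong)
open import Data.List.Relation.Unary.All as All using (All; []; _∷_)
open import Data.List.Relation.Unary.AllPairs using (_∷_)
open import Data.List.Relation.Unary.Unique.Propositional using (Unique)
open import Data.List.Relation.Unary.Unique.Propositional.Properties using (tabulate⁺)
open import Data.Maybe using (Maybe; just; nothing)
open import Data.Nat as ℕ using (ℕ; zero; suc; z≤n; s≤s)
import Data.Nat.Properties as ℕₚ
open import Data.Product using (Σ; _×_; _,_; proj₁; proj₂)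
open import Data.Rational
open import Data.Rational.Properties
open import Data.Rational.Solver using (module +-*-Solver)
open import Data.Sum using (inj₁; inj₂)
open import Data.Unit using (⊤; tt)
open import Function using (_∘_)
open import Relation.Binary.PropositionalEquality
open import Relation.Binary using (Monotonic₁; tri<; tri≈; tri>)
open import Relation.Nullary using (¬_; yes; no; contradiction)
open +-*-Solver

<⇒≱ : ∀ {p q} → p < q → ¬ q ≤ p
<⇒≱ p<q q≤p = <-irrefl refl (<-≤-trans p<q q≤p)

0≤½ : 0ℚ ≤ ½
0≤½ = nonNegative⁻¹ ½

p≤q⇒0≤q-p : ∀ {p q} → p ≤ q → 0ℚ ≤ q - p
p≤q⇒0≤q-p {p} {q} p≤q = subst (_≤ q - p) (+-inverseʳ p) (+-monoˡ-≤ (- p) p≤q)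

0≤q-p⇒p≤q : ∀ {p q} → 0ℚ ≤ q - p → p ≤ q
0≤q-p⇒p≤q {p} {q} 0≤q-p =
  subst₂ _≤_ (+-identityˡ p) (solve 2 (λ p q → q :- p :+ p := q) refl p q) (+-monoˡ-≤ p 0≤q-p)

*-monoˡ-≤-0≤ : ∀ {r p q} → 0ℚ ≤ r → p ≤ q → r * p ≤ r * q
*-monoˡ-≤-0≤ {r} 0≤r = *-monoˡ-≤-nonNeg r {{nonNegative 0≤r}}

*-monoʳ-≤-0≤ : ∀ {r p q} → 0ℚ ≤ r → p ≤ q → p * r ≤ q * r
*-monoʳ-≤-0≤ {r} 0≤r = *-monoʳ-≤-nonNeg r {{nonNegative 0≤r}}

0≤*0≤ : ∀ {p q} → 0ℚ ≤ p → 0ℚ ≤ q → 0ℚ ≤ p * q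
0≤*0≤ {p} 0≤p 0≤q = subst (_≤ p * _) (*-zeroʳ p) (*-monoˡ-≤-0≤ 0≤p 0≤q)

*-zero-length : ∀ v {S C} → S ≡ C → v * (C - S) ≡ 0ℚ
*-zero-length v {C = C} refl = trans (cong (v *_) (+-inverseʳ C)) (*-zeroʳ v)

*-split-length : ∀ v x y z t → v * (y - x) + (v * (z - y) + t) ≡ v * (z - x) + t
*-split-length = solve 5 (λ v x y z t → v :* (y :- x) :+ (v :* (z :- y) :+ t) := v :* (z :- x) :+ t) refl

½[p+s]-s≡½[p-s] : ∀ p s → ½ * (p + s) - s ≡ ½ * (p - s)
½[p+s]-s≡½[p-s] = solve 2 (λ p s → con ½ :* (p :+ s) :- s := con ½ :* (p :- s)) refl

p-½[p+s]≡½[p-s] : ∀ p s → p - ½ * (p + s) ≡ ½ * (p - s)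
p-½[p+s]≡½[p-s] = solve 2 (λ p s → p :- con ½ :* (p :+ s) := con ½ :* (p :- s)) refl

s≤½[p+s] : ∀ {p s} → s ≤ p → s ≤ ½ * (p + s)
s≤½[p+s] {p} {s} s≤p =
  0≤q-p⇒p≤q (subst (0ℚ ≤_) (sym (½[p+s]-s≡½[p-s] p s)) (0≤*0≤ 0≤½ (p≤q⇒0≤q-p s≤p)))

½[p+s]≤p : ∀ {p s} → s ≤ p → ½ * (p + s) ≤ p
½[p+s]≤p {p} {s} s≤p =
  0≤q-p⇒p≤q (subst (0ℚ ≤_) (sym (p-½[p+s]≡½[p-s] p s)) (0≤*0≤ 0≤½ (p≤q⇒0≤q-p s≤p)))

s<½[p+s]⇒s≤p : ∀ {p s} → s < ½ * (p + s) → s ≤ p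
s<½[p+s]⇒s≤p {p} {s} s<½[p+s] with s ≤? p
... | yes s≤p = s≤p
... | no s≰p = contradiction (subst (_≤ s) (cong (½ *_) (+-comm s p)) (½[p+s]≤p (<⇒≤ (≰⇒> s≰p))))
                             (<⇒≱ s<½[p+s])

0<½[p+0] : ∀ {p} → 0ℚ < p → 0ℚ < ½ * (p + 0ℚ)
0<½[p+0] {p} 0<p = positive⁻¹ (½ * (p + 0ℚ))
  {{pos*pos⇒pos ½ (p + 0ℚ) {{positive (subst (0ℚ <_) (sym (+-identityʳ p)) 0<p)}}}}

-- A list E of triples (a , S , C) places item a on the interval (S , C).
module _ {A : Set} where

  Chain : ℚ → List (A × ℚ × ℚ) → Set
  Chain q [] = ⊤
  Chain q ((a , S , C) ∷ E) = q ≤ S × S ≤ C × Chain C E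

  weightedLength : (A → ℚ) → List (A × ℚ × ℚ) → ℚ
  weightedLength wt [] = 0ℚ
  weightedLength wt ((a , S , C) ∷ E) = wt a * (C - S) + weightedLength wt E

-- A step function on (q , b_m] is a list of steps (h_i , b_i): height h_i on (b_{i-1} , b_i],
-- with b_0 = q.
IsStepFunction : ℚ → List (ℚ × ℚ) → Set
IsStepFunction q [] = ⊤
IsStepFunction q ((h , b) ∷ L) = q ≤ b × 0ℚ ≤ h × IsStepFunction b L

area : ℚ → List (ℚ × ℚ) → ℚ
area q [] = 0ℚ
area q ((h , b) ∷ L) = h * (b - q) + area b L

-- The step function is at least v on (q , C), and C does not exceed its last end point.
UnderSteps : ℚ → List (ℚ × ℚ) → ℚ → ℚ → Set
UnderSteps q [] v C = C ≤ q
UnderSteps q ((h , b) ∷ L) v C = (q < C → v ≤ h) × UnderSteps b L v C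

area-nonneg : ∀ q L → IsStepFunction q L → 0ℚ ≤ area q L
area-nonneg q [] _ = ≤-refl
area-nonneg q ((h , b) ∷ L) (q≤b , 0≤h , steps) =
  +-mono-≤ (0≤*0≤ 0≤h (p≤q⇒0≤q-p q≤b)) (area-nonneg b L steps)

UnderSteps-mono : ∀ {q q'} L {v C} → q ≤ q' → UnderSteps q L v C → UnderSteps q' L v C
UnderSteps-mono [] q≤q' C≤q = ≤-trans C≤q q≤q'
UnderSteps-mono ((h , b) ∷ L) q≤q' (v≤h , under) = (λ q'<C → v≤h (≤-<-trans q≤q' q'<C)) , under

UnderSteps-beyond : ∀ {q} L {v C} → IsStepFunction q L → C ≤ q → UnderSteps q L v C
UnderSteps-beyond [] _ C≤q = C≤q
UnderSteps-beyond ((h , b) ∷ L) (q≤b , _ , steps) C≤q =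
  (λ q<C → contradiction C≤q (<⇒≱ q<C)) , UnderSteps-beyond L steps (≤-trans C≤q q≤b)

-- Degenerate pieces (C ≤ q forces S = C) contribute nothing, whatever the sign of v.
piece≤step : ∀ {v h q S C} → 0ℚ ≤ h → q ≤ S → S ≤ C → (q < C → v ≤ h) → v * (C - S) ≤ h * (C - q)
piece≤step {v} {h} {q} {S} {C} 0≤h q≤S S≤C v≤h with q <? C
... | yes q<C = ≤-trans (*-monoʳ-≤-0≤ (p≤q⇒0≤q-p S≤C) (v≤h q<C))
                        (*-monoˡ-≤-0≤ 0≤h (+-monoʳ-≤ C (neg-antimono-≤ q≤S)))
... | no q≮C = subst (_≤ h * (C - q)) (sym (*-zero-length v (≤-antisym S≤C (≤-trans (≮⇒≥ q≮C) q≤S))))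
                     (0≤*0≤ 0≤h (p≤q⇒0≤q-p (≤-trans q≤S S≤C)))

module _ {A : Set} (wt : A → ℚ) where

  Beneath : ℚ → List (ℚ × ℚ) → A × ℚ × ℚ → Set
  Beneath q L (a , S , C) = UnderSteps q L (wt a) C

  AreaBound : List (ℚ × ℚ) → Set
  AreaBound L = ∀ q E → IsStepFunction q L → Chain q E → All (Beneath q L) E →
                weightedLength wt E ≤ area q L

  weightedLength≤area-[] : AreaBound []
  weightedLength≤area-[] q [] _ _ _ = ≤-refl
  weightedLength≤area-[] q ((a , S , C) ∷ E) _ (q≤S , S≤C , chain) (C≤q ∷ under) = begin
    wt a * (C - S) + weightedLength wt E ≡⟨ cong (_+ weightedLength wt E) (*-zero-length (wt a) S≡C) ⟩
    0ℚ + weightedLength wt E             ≡⟨ +-identityˡ _ ⟩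
    weightedLength wt E                  ≤⟨ weightedLength≤area-[] C E tt chain
                                              (All.map (λ C'≤q → ≤-trans C'≤q (≤-trans q≤S S≤C)) under) ⟩
    0ℚ                                   ∎
    where
    open ≤-Reasoning
    S≡C : S ≡ C
    S≡C = ≤-antisym S≤C (≤-trans C≤q q≤S)

  -- An interval (S , C) either ends within the first step, starts after it, or is cut at its end b.
  weightedLength≤area-∷ : ∀ h b L → AreaBound L → AreaBound ((h , b) ∷ L)
  weightedLength≤area-∷ h b L bound q [] steps _ _ = area-nonneg q ((h , b) ∷ L) steps
  weightedLength≤area-∷ h b L bound q ((a , S , C) ∷ E) (q≤b , 0≤h , steps) (q≤S , S≤C , chain)
                         ((v≤h , underL) ∷ under) with C ≤? b | b ≤? S
  ... | yes C≤b | _ = begin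
    wt a * (C - S) + weightedLength wt E
      ≤⟨ +-mono-≤ (piece≤step 0≤h q≤S S≤C v≤h)
                  (weightedLength≤area-∷ h b L bound C E (C≤b , 0≤h , steps) chain
                    (All.map (UnderSteps-mono ((h , b) ∷ L) (≤-trans q≤S S≤C)) under)) ⟩
    h * (C - q) + (h * (b - C) + area b L) ≡⟨ *-split-length h q C b (area b L) ⟩
    h * (b - q) + area b L                 ∎
    where open ≤-Reasoning
  ... | no _ | yes b≤S = begin
    wt a * (C - S) + weightedLength wt E ≤⟨ bound b ((a , S , C) ∷ E) steps (b≤S , S≤C , chain)
                                                  (underL ∷ All.map proj₂ under) ⟩
    area b L                             ≡⟨ +-identityˡ _ ⟨
    0ℚ + area b L                        ≤⟨ +-monoˡ-≤ (area b L) (0≤*0≤ 0≤h (p≤q⇒0≤q-p q≤b)) ⟩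
    h * (b - q) + area b L               ∎
    where open ≤-Reasoning
  ... | no C≰b | no b≰S = begin
    wt a * (C - S) + weightedLength wt E                      ≡⟨ *-split-length (wt a) S b C _ ⟨
    wt a * (b - S) + (wt a * (C - b) + weightedLength wt E)
      ≤⟨ +-mono-≤ (piece≤step 0≤h q≤S (<⇒≤ S<b) (λ _ → v≤h (≤-<-trans q≤S (<-trans S<b b<C))))
                  (bound b ((a , b , C) ∷ E) steps (≤-refl , <⇒≤ b<C , chain)
                         (underL ∷ All.map proj₂ under)) ⟩
    h * (b - q) + area b L                                    ∎
    where
    open ≤-Reasoning
    b<C : b < C
    b<C = ≰⇒> C≰b
    S<b : S < b
    S<b = ≰⇒> b≰S

  weightedLength≤area : ∀ L → AreaBound L
  weightedLength≤area [] = weightedLength≤area-[]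
  weightedLength≤area ((h , b) ∷ L) = weightedLength≤area-∷ h b L (weightedLength≤area L)

Σjobs-cong : ∀ {n} {f g : Fin n → ℚ} → (∀ j → f j ≡ g j) → Σjobs f ≡ Σjobs g
Σjobs-cong f≗g = cong sumℚ (tabulate-cong f≗g)

Σjobs-0 : ∀ n → Σjobs {n} (λ _ → 0ℚ) ≡ 0ℚ
Σjobs-0 zero = refl
Σjobs-0 (suc n) = trans (+-identityˡ _) (Σjobs-0 n)

Σjobs-update : ∀ {n} (f g : Fin n → ℚ) k d → f k ≡ g k + d → (∀ j → j ≢ k → f j ≡ g j) →
               Σjobs f ≡ Σjobs g + d
Σjobs-update {suc n} f g Fin.zero d fk f≗g = begin
  f Fin.zero + Σjobs (f ∘ Fin.suc)       ≡⟨ cong₂ _+_ fk (Σjobs-cong (λ j → f≗g (Fin.suc j) λ ())) ⟩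
  g Fin.zero + d + Σjobs (g ∘ Fin.suc)   ≡⟨ solve 3 (λ x d y → x :+ d :+ y := x :+ y :+ d) refl (g Fin.zero) d _ ⟩
  g Fin.zero + Σjobs (g ∘ Fin.suc) + d   ∎
  where open ≡-Reasoning
Σjobs-update {suc n} f g (Fin.suc k) d fk f≗g = begin
  f Fin.zero + Σjobs (f ∘ Fin.suc)       ≡⟨ cong₂ _+_ (f≗g Fin.zero λ ())
                                              (Σjobs-update (f ∘ Fin.suc) (g ∘ Fin.suc) k d fk
                                                (λ j j≢k → f≗g (Fin.suc j) (j≢k ∘ Finₚ.suc-injective))) ⟩
  g Fin.zero + (Σjobs (g ∘ Fin.suc) + d) ≡⟨ +-assoc (g Fin.zero) _ d ⟨
  g Fin.zero + Σjobs (g ∘ Fin.suc) + d   ∎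
  where open ≡-Reasoning

module _ {n : ℕ} where

  findJob-∉ : ∀ {k : Fin n} ts → All (k ≢_) (map proj₁ ts) → findJob k ts ≡ nothing
  findJob-∉ [] _ = refl
  findJob-∉ {k} ((k' , _) ∷ ts) (k≢k' ∷ k∉ts) with k Fin.≟ k'
  ... | yes k≡k' = contradiction k≡k' k≢k'
  ... | no _ = findJob-∉ ts k∉ts

  Chain-findJob : ∀ {s} (ts : List (Fin n × ℚ × ℚ)) {j S C} → Chain s ts →
                  findJob j ts ≡ just (S , C) → s ≤ S × S ≤ C
  Chain-findJob ((k , S₀ , C₀) ∷ ts) {j} (s≤S₀ , S₀≤C₀ , chain) found with j Fin.≟ k
  Chain-findJob ((k , S₀ , C₀) ∷ ts) (s≤S₀ , S₀≤C₀ , chain) refl | yes _ = s≤S₀ , S₀≤C₀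
  ... | no _ = let C₀≤S , S≤C = Chain-findJob ts chain found in ≤-trans s≤S₀ (≤-trans S₀≤C₀ C₀≤S) , S≤C

  Chain-findJob-disjoint : ∀ {s} (ts : List (Fin n × ℚ × ℚ)) {j j' S C S' C'} → Chain s ts →
                           findJob j ts ≡ just (S , C) → findJob j' ts ≡ just (S' , C') → j ≢ j' →
                           Disjoint (S , C) (S' , C')
  Chain-findJob-disjoint ((k , S₀ , C₀) ∷ ts) {j} {j'} (_ , _ , chain) found found' j≢j'
    with j Fin.≟ k | j' Fin.≟ k
  ... | yes j≡k | yes j'≡k = contradiction (trans j≡k (sym j'≡k)) j≢j'
  Chain-findJob-disjoint ((k , S₀ , C₀) ∷ ts) (_ , _ , chain) refl found' _ | yes _ | no _ =
    inj₁ (proj₁ (Chain-findJob ts chain found'))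
  Chain-findJob-disjoint ((k , S₀ , C₀) ∷ ts) (_ , _ , chain) found refl _ | no _ | yes _ =
    inj₂ (proj₁ (Chain-findJob ts chain found))
  ... | no _ | no _ = Chain-findJob-disjoint ts chain found found' j≢j'

  contribution : (Fin n → ℚ) → Fin n → Maybe (ℚ × ℚ) → ℚ
  contribution w j nothing = 0ℚ
  contribution w j (just (S , C)) = w j * (C - S)

  Σjobs-contribution : ∀ (w : Fin n → ℚ) ts → Unique (map proj₁ ts) →
                       Σjobs (λ j → contribution w j (findJob j ts)) ≡ weightedLength w ts
  Σjobs-contribution w [] _ = Σjobs-0 n
  Σjobs-contribution w ((k , S , C) ∷ ts) (k∉ts ∷ unique) = begin
    Σjobs (λ j → contribution w j (findJob j ((k , S , C) ∷ ts)))
      ≡⟨ Σjobs-update _ _ k (w k * (C - S)) at-k elsewhere ⟩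
    Σjobs (λ j → contribution w j (findJob j ts)) + w k * (C - S)
      ≡⟨ cong (_+ w k * (C - S)) (Σjobs-contribution w ts unique) ⟩
    weightedLength w ts + w k * (C - S)
      ≡⟨ +-comm (weightedLength w ts) _ ⟩
    w k * (C - S) + weightedLength w ts ∎
    where
    open ≡-Reasoning
    at-k : contribution w k (findJob k ((k , S , C) ∷ ts)) ≡
           contribution w k (findJob k ts) + w k * (C - S)
    at-k with k Fin.≟ k
    ... | no k≢k = contradiction refl k≢k
    ... | yes _ rewrite findJob-∉ ts k∉ts = sym (+-identityˡ _)
    elsewhere : ∀ j → j ≢ k →
                contribution w j (findJob j ((k , S , C) ∷ ts)) ≡ contribution w j (findJob j ts)
    elsewhere j j≢k with j Fin.≟ k
    ... | yes j≡k = contradiction j≡k j≢k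
    ... | no _ = refl

overlapLen-self : ∀ {S C} → 0ℚ ≤ S → S ≤ C → overlapLen C (S , C) ≡ C - S
overlapLen-self {S} {C} 0≤S S≤C = begin
  0ℚ ⊔ ((C ⊓ C) - (0ℚ ⊔ S)) ≡⟨ cong₂ (λ x y → 0ℚ ⊔ (x - y)) (⊓-idem C) (p≤q⇒p⊔q≡q 0≤S) ⟩
  0ℚ ⊔ (C - S)              ≡⟨ p≤q⇒p⊔q≡q (p≤q⇒0≤q-p S≤C) ⟩
  C - S                     ∎
  where open ≡-Reasoning

module _ {n : ℕ} (p : Fin n → ℚ) where

  syncTimes-jobs : ∀ s seq → map proj₁ (syncTimes p s seq) ≡ seq
  syncTimes-jobs s [] = refl
  syncTimes-jobs s (j ∷ seq) = cong (j ∷_) (syncTimes-jobs _ seq)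

  findJob-syncTimes : ∀ s seq {j S C} → findJob j (syncTimes p s seq) ≡ just (S , C) → C ≡ ½ * (p j + S)
  findJob-syncTimes s (k ∷ seq) {j} found with j Fin.≟ k
  findJob-syncTimes s (k ∷ seq) refl | yes refl = refl
  ... | no _ = findJob-syncTimes _ seq found

  syncSchedule-feasible : ∀ seq → (∀ j → 0ℚ ≤ p j) → Chain 0ℚ (syncTimes p 0ℚ seq) →
                          Feasible p (syncSchedule p seq)
  syncSchedule-feasible seq 0≤p chain .Feasible.cp-nonneg j with findJob j (syncTimes p 0ℚ seq) in found
  ... | just (S , C) = let 0≤S , S≤C = Chain-findJob _ chain found in ≤-trans 0≤S S≤C
  ... | nothing = 0≤p j
  syncSchedule-feasible seq 0≤p chain .Feasible.iv-wf j x with findJob j (syncTimes p 0ℚ seq) in found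
  syncSchedule-feasible seq 0≤p chain .Feasible.iv-wf j Fin.zero | just (S , C) = Chain-findJob _ chain found
  syncSchedule-feasible seq 0≤p chain .Feasible.total j with findJob j (syncTimes p 0ℚ seq) in found
  ... | just (S , C) = begin
    C + ((C - S) + 0ℚ)    ≡⟨ cong (λ C → C + ((C - S) + 0ℚ)) (findJob-syncTimes 0ℚ seq found) ⟩
    ½ * (p j + S) + ((½ * (p j + S) - S) + 0ℚ)
      ≡⟨ solve 2 (λ p S → con ½ :* (p :+ S) :+ ((con ½ :* (p :+ S) :- S) :+ con 0ℚ) := p) refl (p j) S ⟩
    p j                   ∎
    where open ≡-Reasoning
  ... | nothing = +-identityʳ (p j)
  syncSchedule-feasible seq 0≤p chain .Feasible.disjoint j j' x y distinct
    with findJob j (syncTimes p 0ℚ seq) in found | findJob j' (syncTimes p 0ℚ seq) in found'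
  syncSchedule-feasible seq 0≤p chain .Feasible.disjoint j j' Fin.zero Fin.zero distinct
    | just (S , C) | just (S' , C') =
    Chain-findJob-disjoint _ chain found found' (λ j≡j' → distinct (j≡j' , refl))

  W-syncSchedule : ∀ (w : Fin n → ℚ) seq → Unique seq → Chain 0ℚ (syncTimes p 0ℚ seq) →
                   W w (syncSchedule p seq) ≡ weightedLength w (syncTimes p 0ℚ seq)
  W-syncSchedule w seq unique chain = trans (Σjobs-cong overlap*w)
    (Σjobs-contribution w _ (subst Unique (sym (syncTimes-jobs 0ℚ seq)) unique))
    where
    overlap*w : ∀ j → overlapTime (syncSchedule p seq) j * w j ≡
                      contribution w j (findJob j (syncTimes p 0ℚ seq))
    overlap*w j with findJob j (syncTimes p 0ℚ seq) in found
    ... | nothing = *-zeroˡ (w j)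
    ... | just (S , C) = let 0≤S , S≤C = Chain-findJob _ chain found in begin
      (overlapLen C (S , C) + 0ℚ) * w j ≡⟨ cong (_* w j) (trans (+-identityʳ _) (overlapLen-self 0≤S S≤C)) ⟩
      (C - S) * w j                     ≡⟨ *-comm (C - S) (w j) ⟩
      w j * (C - S)                     ∎
      where open ≡-Reasoning

  estar≡weightedLength : ∀ (w : Fin n → ℚ) π → estar p w π ≡ weightedLength w (syncTimes p 0ℚ π)
  estar≡weightedLength w = go 0ℚ
    where
    go : ∀ s π → estarGo w s π (map (λ t → proj₂ (proj₂ t)) (syncTimes p s π)) ≡
                 weightedLength w (syncTimes p s π)
    go s [] = refl
    go s (j ∷ π) = cong (w j * (½ * (p j + s) - s) +_) (go _ π)

  syncCompletions-from-0 : (∀ j → 0ℚ < p j) → ∀ π → StrictlyIncreasing (syncCompletions p π) →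
                           StrictlyIncreasing (0ℚ ∷ syncCompletions p π)
  syncCompletions-from-0 0<p [] _ = tt
  syncCompletions-from-0 0<p (j ∷ _) increasing = 0<½[p+0] (0<p j) , increasing

  EndsBy : Fin n × ℚ × ℚ → Set
  EndsBy (j , S , C) = C ≤ p j

  syncTimes-increasing : ∀ s seq →
                         StrictlyIncreasing (s ∷ map (λ t → proj₂ (proj₂ t)) (syncTimes p s seq)) →
                         Chain s (syncTimes p s seq) × All EndsBy (syncTimes p s seq)
  syncTimes-increasing s [] _ = tt , []
  syncTimes-increasing s (j ∷ []) (s<C , _) =
    (≤-refl , <⇒≤ s<C , tt) , ½[p+s]≤p (s<½[p+s]⇒s≤p s<C) ∷ []
  syncTimes-increasing s (j ∷ j' ∷ seq) (s<C , increasing) =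
    let chain , endsBy = syncTimes-increasing _ (j' ∷ seq) increasing
    in (≤-refl , <⇒≤ s<C , chain) , ½[p+s]≤p (s<½[p+s]⇒s≤p s<C) ∷ endsBy

  module _ (w : Fin n → ℚ) where

    jobStep : Fin n → ℚ × ℚ
    jobStep k = w k , p k

    syncTimes-chain : ∀ s q seq → s ≤ q → IsStepFunction q (map jobStep seq) → Chain s (syncTimes p s seq)
    syncTimes-chain s q [] _ _ = tt
    syncTimes-chain s q (k ∷ seq) s≤q (q≤pk , _ , steps) =
      ≤-refl , s≤½[p+s] s≤pk , syncTimes-chain _ (p k) seq (½[p+s]≤p s≤pk) steps
      where
      s≤pk : s ≤ p k
      s≤pk = ≤-trans s≤q q≤pk

    -- Starting at s ≤ q, job k runs on M for ½(p_k − s) ≥ ½(p_k − q).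
    ½*area≤weightedLength : ∀ s q seq → s ≤ q → IsStepFunction q (map jobStep seq) →
                            ½ * area q (map jobStep seq) ≤ weightedLength w (syncTimes p s seq)
    ½*area≤weightedLength s q [] _ _ = ≤-reflexive (*-zeroʳ ½)
    ½*area≤weightedLength s q (k ∷ seq) s≤q (q≤pk , 0≤wk , steps) = begin
      ½ * (w k * (p k - q) + area (p k) (map jobStep seq))
        ≡⟨ *-distribˡ-+ ½ (w k * (p k - q)) _ ⟩
      ½ * (w k * (p k - q)) + ½ * area (p k) (map jobStep seq)
        ≤⟨ +-mono-≤ first (½*area≤weightedLength _ (p k) seq (½[p+s]≤p (≤-trans s≤q q≤pk)) steps) ⟩
      w k * (½ * (p k + s) - s) + weightedLength w (syncTimes p (½ * (p k + s)) seq) ∎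
      where
      open ≤-Reasoning
      first : ½ * (w k * (p k - q)) ≤ w k * (½ * (p k + s) - s)
      first = begin
        ½ * (w k * (p k - q)) ≡⟨ solve 3 (λ h a b → h :* (a :* b) := a :* (h :* b)) refl ½ (w k) (p k - q) ⟩
        w k * (½ * (p k - q))
          ≤⟨ *-monoˡ-≤-0≤ 0≤wk (*-monoˡ-≤-0≤ 0≤½ (+-monoʳ-≤ (p k) (neg-antimono-≤ s≤q))) ⟩
        w k * (½ * (p k - s)) ≡⟨ cong (w k *_) (½[p+s]-s≡½[p-s] (p k) s) ⟨
        w k * (½ * (p k + s) - s) ∎

    stepStart : ∀ {m} → ℚ → (Fin m → Fin n) → Fin m → ℚ
    stepStart q g Fin.zero = q
    stepStart q g (Fin.suc a) = p (g (inject₁ a))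

    module _ (0≤w : ∀ k → 0ℚ ≤ w k) where

      tabulate-isStepFunction : ∀ {m} q (g : Fin m → Fin n) → (∀ a → q ≤ p (g a)) →
                                Monotonic₁ Fin._≤_ _≤_ (p ∘ g) → IsStepFunction q (map jobStep (tabulate g))
      tabulate-isStepFunction {zero} q g _ _ = tt
      tabulate-isStepFunction {suc m} q g q≤pg mono =
        q≤pg Fin.zero , 0≤w (g Fin.zero) , tabulate-isStepFunction _ (g ∘ Fin.suc) (λ _ → mono z≤n) (mono ∘ s≤s)

      tabulate-underSteps : ∀ {m} q (g : Fin m → Fin n) {v C} → Monotonic₁ Fin._≤_ _≤_ (p ∘ g) →
                            (∀ a → stepStart q g a < C → v ≤ w (g a)) → Σ (Fin m) (λ a → C ≤ p (g a)) →
                            UnderSteps q (map jobStep (tabulate g)) v C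
      tabulate-underSteps {suc m} q g mono v≤w (Fin.zero , C≤pg) =
        v≤w Fin.zero ,
        UnderSteps-beyond _ (tabulate-isStepFunction _ (g ∘ Fin.suc) (λ _ → mono z≤n) (mono ∘ s≤s)) C≤pg
      tabulate-underSteps {suc m} q g {v} {C} mono v≤w (Fin.suc a , C≤pg) =
        v≤w Fin.zero , tabulate-underSteps _ (g ∘ Fin.suc) (mono ∘ s≤s) v≤w-tail (a , C≤pg)
        where
        v≤w-tail : ∀ a → stepStart (p (g Fin.zero)) (g ∘ Fin.suc) a < C → v ≤ w (g (Fin.suc a))
        v≤w-tail Fin.zero = v≤w (Fin.suc Fin.zero)
        v≤w-tail (Fin.suc b) = v≤w (Fin.suc (Fin.suc b))

-- Induction on a: if k lies before block a, move to block a − 1; otherwise k is in block a.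
w≤w-key : ∀ {n ℓ} {w : Fin n → ℚ} (key : Fin ℓ → Fin n) → IsKeySequence w key →
          ∀ k a' a → a' Fin.≤ a → prevEnd key a' ℕ.≤ toℕ k → k Fin.≤ key a → w k ≤ w (key a')
w≤w-key {ℓ = suc ℓ} {w} key isKey k a' a = Finᵢ.<-weakInduction Dominated base step a a'
  where
  open IsKeySequence isKey
  Dominated : Fin (suc ℓ) → Set
  Dominated a = ∀ a' → a' Fin.≤ a → prevEnd key a' ℕ.≤ toℕ k → k Fin.≤ key a → w k ≤ w (key a')
  base : Dominated Fin.zero
  base Fin.zero _ start≤k k≤key = dominates Fin.zero k start≤k k≤key
  step : ∀ i → Dominated (inject₁ i) → Dominated (Fin.suc i)
  step i ih a' a'≤1+i start≤k k≤key with a' Fin.≟ Fin.suc i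
  ... | yes refl = dominates _ k start≤k k≤key
  ... | no a'≢1+i with k Finₚ.≤? key (inject₁ i)
  ...   | yes k≤prev = ih a' a'≤i start≤k k≤prev
    where
    a'≤i : a' Fin.≤ inject₁ i
    a'≤i = subst (toℕ a' ℕ.≤_) (sym (Finₚ.toℕ-inject₁ i)) (ℕₚ.≤-pred (Finₚ.≤∧≢⇒< a'≤1+i a'≢1+i))
  ...   | no k≰prev = ≤-trans (dominates (Fin.suc i) k (ℕₚ.≰⇒> k≰prev) k≤key)
                              (<⇒≤ (decreasing a' (Fin.suc i) (Finₚ.≤∧≢⇒< a'≤1+i a'≢1+i)))

module KeySequence {n : ℕ} (p w : Fin n → ℚ) (0<p : ∀ j → 0ℚ < p j) (0≤w : ∀ j → 0ℚ ≤ w j)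
                   (sorted : SortedJobs p w) {ℓ : ℕ} (key : Fin ℓ → Fin n) (isKey : IsKeySequence w key) where

  open IsKeySequence isKey

  lastIndex : Fin ℓ
  lastIndex = proj₁ last

  ≤lastIndex : ∀ a → a Fin.≤ lastIndex
  ≤lastIndex a = ℕₚ.≤-pred (subst (suc (toℕ a) ℕ.≤_) (sym (proj₁ (proj₂ last))) (Finₚ.toℕ<n a))

  ≤key-lastIndex : ∀ k → k Fin.≤ key lastIndex
  ≤key-lastIndex k = ℕₚ.≤-pred (subst (suc (toℕ k) ℕ.≤_) (sym (proj₂ (proj₂ last))) (Finₚ.toℕ<n k))

  p∘key-mono : Monotonic₁ Fin._≤_ _≤_ (p ∘ key)
  p∘key-mono {a} {b} a≤b with a Fin.≟ b
  ... | yes refl = ≤-refl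
  ... | no a≢b = proj₁ sorted (key a) (key b) (ℕₚ.<⇒≤ (increasing a b (Finₚ.≤∧≢⇒< a≤b a≢b)))

  key-injective : ∀ {a b} → key a ≡ key b → a ≡ b
  key-injective {a} {b} ka≡kb with Finₚ.<-cmp a b
  ... | tri< a<b _ _ = contradiction (subst (key a Fin.<_) (sym ka≡kb) (increasing a b a<b))
                                     (Finₚ.<-irrefl refl)
  ... | tri≈ _ a≡b _ = a≡b
  ... | tri> _ _ b<a = contradiction (subst (key b Fin.<_) ka≡kb (increasing b a b<a))
                                     (Finₚ.<-irrefl refl)

  prevEnd≤ : ∀ k a → stepStart p w 0ℚ key a < p k → prevEnd key a ℕ.≤ toℕ k
  prevEnd≤ k Fin.zero _ = z≤n
  prevEnd≤ k (Fin.suc a) start<pk with k Finₚ.≤? key (inject₁ a)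
  ... | yes k≤prev = contradiction (proj₁ sorted k _ k≤prev) (<⇒≱ start<pk)
  ... | no k≰prev = ℕₚ.≰⇒> k≰prev

  keySteps : List (ℚ × ℚ)
  keySteps = map (jobStep p w) (keyList key)

  keySteps-isStepFunction : IsStepFunction 0ℚ keySteps
  keySteps-isStepFunction = tabulate-isStepFunction p w 0≤w 0ℚ key (λ a → <⇒≤ (0<p (key a))) p∘key-mono

  UnderSteps-key : ∀ {k C} → C ≤ p k → UnderSteps 0ℚ keySteps (w k) C
  UnderSteps-key {k} C≤pk =
    tabulate-underSteps p w 0≤w 0ℚ key p∘key-mono
      (λ a start<C → w≤w-key key isKey k a lastIndex (≤lastIndex a)
                               (prevEnd≤ k a (<-≤-trans start<C C≤pk)) (≤key-lastIndex k))
      (lastIndex , ≤-trans C≤pk (proj₁ sorted k _ (≤key-lastIndex k)))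

  keyTimes : List (Fin n × ℚ × ℚ)
  keyTimes = syncTimes p 0ℚ (keyList key)

  keyTimes-chain : Chain 0ℚ keyTimes
  keyTimes-chain = syncTimes-chain p w 0ℚ 0ℚ (keyList key) ≤-refl keySteps-isStepFunction

  keyList-unique : Unique (keyList key)
  keyList-unique = tabulate⁺ key-injective

module IncreasingSequence {n : ℕ} (p : Fin n → ℚ) (0<p : ∀ j → 0ℚ < p j) (π : List (Fin n))
                          (increasing : StrictlyIncreasing (syncCompletions p π)) where

  πTimes : List (Fin n × ℚ × ℚ)
  πTimes = syncTimes p 0ℚ π

  increasing-from-0 : StrictlyIncreasing (0ℚ ∷ syncCompletions p π)
  increasing-from-0 = syncCompletions-from-0 p 0<p π increasing

  πTimes-chain : Chain 0ℚ πTimes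
  πTimes-chain = proj₁ (syncTimes-increasing p 0ℚ π increasing-from-0)

  πTimes-endsBy : All (EndsBy p) πTimes
  πTimes-endsBy = proj₂ (syncTimes-increasing p 0ℚ π increasing-from-0)

corollary1 : {n : ℕ} (p w : Fin n → ℚ) →
    (∀ j → 0ℚ < p j) → (∀ j → 0ℚ ≤ w j) →
    SortedJobs p w →
    {ℓ : ℕ} (key : Fin ℓ → Fin n) → IsKeySequence w key →
    (π : List (Fin n)) → Unique π →
    Optimal p w (syncSchedule p π) →
    StrictlyIncreasing (syncCompletions p π) →
    (½ * estar p w π ≤ W w (syncSchedule p (keyList key)))
      × (W w (syncSchedule p (keyList key)) ≤ estar p w π)
corollary1 {n} p w 0<p 0≤w sorted key isKey π π-unique (_ , π-optimal) π-increasing = lower , upper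
  where
  open KeySequence p w 0<p 0≤w sorted key isKey
  open IncreasingSequence p 0<p π π-increasing
  open ≤-Reasoning
  key-feasible : Feasible p (syncSchedule p (keyList key))
  key-feasible = syncSchedule-feasible p (keyList key) (λ j → <⇒≤ (0<p j)) keyTimes-chain
  πTimes≤keyArea : weightedLength w πTimes ≤ area 0ℚ keySteps
  πTimes≤keyArea = weightedLength≤area w keySteps 0ℚ πTimes keySteps-isStepFunction πTimes-chain
                     (All.map UnderSteps-key πTimes-endsBy)
  upper : W w (syncSchedule p (keyList key)) ≤ estar p w π
  upper = begin
    W w (syncSchedule p (keyList key)) ≤⟨ π-optimal _ key-feasible ⟩
    W w (syncSchedule p π)             ≡⟨ W-syncSchedule p w π π-unique πTimes-chain ⟩
    weightedLength w πTimes            ≡⟨ estar≡weightedLength p w π ⟨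
    estar p w π                        ∎
  lower : ½ * estar p w π ≤ W w (syncSchedule p (keyList key))
  lower = begin
    ½ * estar p w π                    ≡⟨ cong (½ *_) (estar≡weightedLength p w π) ⟩
    ½ * weightedLength w πTimes        ≤⟨ *-monoˡ-≤-0≤ 0≤½ πTimes≤keyArea ⟩
    ½ * area 0ℚ keySteps               ≤⟨ ½*area≤weightedLength p w 0ℚ 0ℚ (keyList key) ≤-refl keySteps-isStepFunction ⟩
    weightedLength w keyTimes          ≡⟨ W-syncSchedule p w (keyList key) keyList-unique keyTimes-chain ⟨
    W w (syncSchedule p (keyList key)) ∎
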